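{- Let $G = \prod_{i=1}^t K[a_i,b_i]$, where $2 \leq b_1 \leq \cdots \leq b_t$. Then $$\mathrm{IR}(G) \leq \frac{1}{b_1}\prod_{i=1}^t a_ib_i + \frac{2}{b_t}\prod_{i=1}^t b_i.$$
   Context: $K[a,b]$ is the balanced complete $b$-partite graph with $b$ parts each of size $a$ (two vertices adjacent iff in different parts). The direct product $\prod_i G_i$ has vertex set $\prod_i V(G_i)$, two tuples adjacent iff adjacent in every coordinate. A set $S$ of vertices is irredundant if every $v\in S$ has a private neighbor, i.e. a vertex in the closed neighborhood of $v$ not in the closed neighborhood of any vertex of $S\setminus\{v\}$. $\mathrm{IR}(G)$, the upper irredundance number, is the maximum size of an irredundant set. -}

module Defs where

open import Data.Nat using (ℕ; zero; suc; _*_)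
open import Data.Fin using (Fin; zero; suc)
open import Data.Product using (Σ; _×_; proj₁; proj₂)
open import Data.Sum using (_⊎_)
open import Relation.Binary.PropositionalEquality using (_≡_; _≢_)
open import Relation.Nullary using (¬_)

∏ : (t : ℕ) → (Fin t → ℕ) → ℕ
∏ zero    f = 1
∏ (suc t) f = f zero * ∏ t (λ i → f (suc i))

-- Vertices of K[a,b]: pairs (element, part), part ∈ Fin b, each part of size a.
-- Two vertices are adjacent iff they lie in different parts.
KVertex : ℕ → ℕ → Set
KVertex a b = Fin a × Fin b

KAdj : ∀ {a b} → KVertex a b → KVertex a b → Set
KAdj u v = proj₂ u ≢ proj₂ v

PVertex : (t : ℕ) → (Fin t → ℕ) → (Fin t → ℕ) → Set
PVertex t a b = (i : Fin t) → KVertex (a i) (b i)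

_≈_ : ∀ {t a b} → PVertex t a b → PVertex t a b → Set
_≈_ {t} u v = (i : Fin t) → u i ≡ v i

PAdj : ∀ {t a b} → PVertex t a b → PVertex t a b → Set
PAdj {t} u v = (i : Fin t) → KAdj (u i) (v i)

InClosedNbhd : ∀ {t a b} → PVertex t a b → PVertex t a b → Set
InClosedNbhd w v = (w ≈ v) ⊎ PAdj w v

-- A set S of m vertices, given as an injective enumeration S : Fin m → V
IsVertexSet : ∀ {t a b} (m : ℕ) → (Fin m → PVertex t a b) → Set
IsVertexSet m S = (j k : Fin m) → S j ≈ S k → j ≡ k

Irredundant : ∀ {t a b} (m : ℕ) → (Fin m → PVertex t a b) → Set
Irredundant {t} {a} {b} m S =
  (k : Fin m) → Σ (PVertex t a b) λ w →
    InClosedNbhd w (S k) × ((j : Fin m) → j ≢ k → ¬ InClosedNbhd w (S j))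

module Submission where

-- Let S be irredundant, pn k a private neighbour of S k, and L the last
-- coordinate.  The bound  |S| · b₀ · b_L ≤ b_L · |V(G)| + 2 · b₀ · ∏ b i  is
-- proved by an explicit injection of the triples (k , r , c), r < b₀, c < b_L:
--   * if pn k = S k, the code is (c , S k with every part rotated by r).
--     Vertices rotated by different amounts are adjacent in every coordinate,
--     so a clash with r ≠ r' would put S k' into N[S k], contradicting the
--     privacy of S k; a clash with r = r' forces S k = S k'.
--   * if pn k is adjacent to S k, the code is the orientation bit of the last
--     parts of S k and pn k, the shift r, and the parts of S k with the last
--     one overwritten by c.  If k ≠ k' clash, S k and S k' differ only in the
--     last coordinate, each private neighbour is forced into the last part of
--     the other vertex, and the two orientation bits are opposite.

open import Defs
open import Data.Nat using (ℕ; suc; _*_; _+_; _≤_)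
open import Data.Fin using (Fin; zero; fromℕ) renaming (_≤_ to _≤ᶠ_)
open import Data.Nat using (zero; _<_; _∸_; _%_; z≤n; NonZero)
open import Data.Nat.Properties using (+-assoc; +-comm; m+[n∸m]≡n; <⇒≤; <-≤-trans; ≮⇒≥)
open import Data.Nat.DivMod using (_mod_; %-distribˡ-+; [m+n]%n≡m%n; m<n⇒m%n≡m)
open import Data.Fin using (suc; toℕ; combine; _≟_)
import Data.Fin.Properties as FinP
open import Data.Bool using (Bool; true; false)
open import Data.Product using (_×_; _,_; proj₁; proj₂)
open import Data.Product.Properties using (×-≡,≡→≡; ×-≡,≡←≡)
open import Data.Product.Function.NonDependent.Propositional using (_×-↔_)
open import Data.Sum using (_⊎_; inj₁; inj₂)
open import Data.Sum.Properties using (inj₁-injective; inj₂-injective)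
open import Data.Sum.Function.Propositional using (_⊎-↔_)
open import Data.Empty using (⊥-elim)
open import Function using (_∘_)
open import Function.Bundles using (_↔_; _↣_; mk↣; Injection)
open import Function.Definitions using (Injective)
open import Function.Properties.Inverse using (↔-refl; ↔-sym; ↔-trans; ↔⇒↣)
open import Function.Construct.Composition using (_↣-∘_)
open import Relation.Nullary using (¬_; ¬?; yes; no)
open import Relation.Nullary.Decidable using (decidable-stable)
open import Relation.Binary.PropositionalEquality

%-cancelʳ : ∀ b .{{_ : NonZero b}} {z u v} → z ≤ b → u < b → v < b →
            (u + z) % b ≡ (v + z) % b → u ≡ v
%-cancelʳ b {z} {u} {v} z≤b u<b v<b eq = begin
  u                                  ≡⟨ fullTurn u u<b ⟨
  (u + z + (b ∸ z)) % b              ≡⟨ %-distribˡ-+ (u + z) (b ∸ z) b ⟩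
  ((u + z) % b + (b ∸ z) % b) % b    ≡⟨ cong (λ x → (x + (b ∸ z) % b) % b) eq ⟩
  ((v + z) % b + (b ∸ z) % b) % b    ≡⟨ %-distribˡ-+ (v + z) (b ∸ z) b ⟨
  (v + z + (b ∸ z)) % b              ≡⟨ fullTurn v v<b ⟩
  v                                  ∎
  where
  open ≡-Reasoning
  fullTurn : ∀ x → x < b → (x + z + (b ∸ z)) % b ≡ x
  fullTurn x x<b = begin
    (x + z + (b ∸ z)) % b  ≡⟨ cong (_% b) (+-assoc x z (b ∸ z)) ⟩
    (x + (z + (b ∸ z))) % b ≡⟨ cong (λ y → (x + y) % b) (m+[n∸m]≡n z≤b) ⟩
    (x + b) % b            ≡⟨ [m+n]%n≡m%n x b ⟩
    x % b                  ≡⟨ m<n⇒m%n≡m x<b ⟩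
    x                      ∎

rotate : ∀ {B} → ℕ → Fin B → Fin B
rotate {suc B} s p = (toℕ p + s) mod suc B

rotate-% : ∀ {B} {s s'} (p q : Fin (suc B)) → rotate s p ≡ rotate s' q →
           (toℕ p + s) % suc B ≡ (toℕ q + s') % suc B
rotate-% p q eq =
  trans (sym (FinP.toℕ-fromℕ< _)) (trans (cong toℕ eq) (FinP.toℕ-fromℕ< _))

rotate-injective : ∀ {B s} {p q : Fin B} → s < B → rotate s p ≡ rotate s q → p ≡ q
rotate-injective {suc B} {s} {p} {q} s<B eq = FinP.toℕ-injective
  (%-cancelʳ (suc B) (<⇒≤ s<B) (FinP.toℕ<n p) (FinP.toℕ<n q) (rotate-% p q eq))

rotate-injectiveˢ : ∀ {B s s'} {p : Fin B} → s < B → s' < B →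
                    rotate s p ≡ rotate s' p → s ≡ s'
rotate-injectiveˢ {suc B} {s} {s'} {p} s<B s'<B eq =
  %-cancelʳ (suc B) (<⇒≤ (FinP.toℕ<n p)) s<B s'<B
    (trans (cong (_% suc B) (+-comm s (toℕ p)))
      (trans (rotate-% p p eq) (cong (_% suc B) (+-comm (toℕ p) s'))))

encodeΠ : ∀ t {G : Fin t → ℕ} → ((i : Fin t) → Fin (G i)) → Fin (∏ t G)
encodeΠ zero    x = zero
encodeΠ (suc t) x = combine (x zero) (encodeΠ t (λ i → x (suc i)))

encodeΠ-injective : ∀ t {G : Fin t → ℕ} (x y : (i : Fin t) → Fin (G i)) →
                    encodeΠ t x ≡ encodeΠ t y → ∀ i → x i ≡ y i
encodeΠ-injective (suc t) x y eq zero =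
  proj₁ (FinP.combine-injective (x zero) _ (y zero) _ eq)
encodeΠ-injective (suc t) x y eq (suc i) =
  encodeΠ-injective t (λ j → x (suc j)) (λ j → y (suc j))
    (proj₂ (FinP.combine-injective (x zero) _ (y zero) _ eq)) i

encodeVertex : ∀ {t a b} → PVertex t a b → Fin (∏ t (λ i → a i * b i))
encodeVertex {t} v = encodeΠ t (λ i → combine (proj₁ (v i)) (proj₂ (v i)))

encodeVertex-injective : ∀ {t a b} {u v : PVertex t a b} →
                         encodeVertex u ≡ encodeVertex v → u ≈ v
encodeVertex-injective {t} eq i =
  ×-≡,≡→≡ (FinP.combine-injective _ _ _ _ (encodeΠ-injective t _ _ eq i))

setLast : ∀ {n} {X : Fin (suc n) → Set} →
          ((i : Fin (suc n)) → X i) → X (fromℕ n) → (i : Fin (suc n)) → X i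
setLast {zero}  x c zero    = c
setLast {suc n} x c zero    = x zero
setLast {suc n} x c (suc i) = setLast (λ j → x (suc j)) c i

setLast-last : ∀ {n} {X : Fin (suc n) → Set} (x : (i : Fin (suc n)) → X i) c →
               setLast x c (fromℕ n) ≡ c
setLast-last {zero}  x c = refl
setLast-last {suc n} x c = setLast-last (λ j → x (suc j)) c

setLast-other : ∀ {n} {X : Fin (suc n) → Set} (x : (i : Fin (suc n)) → X i) c i →
                i ≢ fromℕ n → setLast x c i ≡ x i
setLast-other {zero}  x c zero    i≢L = ⊥-elim (i≢L refl)
setLast-other {suc n} x c zero    i≢L = refl
setLast-other {suc n} x c (suc i) i≢L = setLast-other (λ j → x (suc j)) c i (i≢L ∘ cong suc)

orient : ∀ {B} → Fin B → Fin B → Bool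
orient p q with p FinP.<? q
... | yes _ = true
... | no _  = false

orient-antisym : ∀ {B} (p q : Fin B) → p ≢ q → orient p q ≢ orient q p
orient-antisym p q p≢q with p FinP.<? q | q FinP.<? p
... | yes p<q | yes q<p = λ _ → FinP.<-asym p<q q<p
... | no p≮q  | no q≮p  = λ _ → p≢q (FinP.≤-antisym (≮⇒≥ q≮p) (≮⇒≥ p≮q))
... | yes _   | no _    = λ ()
... | no _    | yes _   = λ ()

parts : ∀ {t a b} → PVertex t a b → (i : Fin t) → Fin (b i)
parts v i = proj₂ (v i)

rotateVertex : ∀ {t a b} → ℕ → PVertex t a b → PVertex t a b
rotateVertex s v i = proj₁ (v i) , rotate s (proj₂ (v i))

rotateVertex-injective : ∀ {t a b s} {u v : PVertex t a b} → (∀ i → s < b i) →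
                         rotateVertex s u ≈ rotateVertex s v → u ≈ v
rotateVertex-injective s<b eq i =
  cong₂ _,_ (cong proj₁ (eq i)) (rotate-injective (s<b i) (cong proj₂ (eq i)))

rotateVertex-separates : ∀ {t a b s s'} {u v : PVertex t a b} →
                         (∀ i → s < b i) → (∀ i → s' < b i) → s ≢ s' →
                         rotateVertex s u ≈ rotateVertex s' v → PAdj u v
rotateVertex-separates {s' = s'} s<b s'<b s≢s' eq i same-part =
  s≢s' (rotate-injectiveˢ (s<b i) (s'<b i)
    (trans (cong proj₂ (eq i)) (cong (rotate s') (sym same-part))))

forcedCoordinate : ∀ {t a b} (j : Fin t) {w u v : PVertex t a b} →
                   PAdj w u → ¬ InClosedNbhd w v →
                   (∀ i → i ≢ j → parts u i ≡ parts v i) → parts w j ≡ parts v j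
forcedCoordinate {t} j {w} {u} {v} w~u w∉N[v] agree
  with i , ¬w~v ← FinP.¬∀⟶∃¬ t (λ i → KAdj (w i) (v i))
                    (λ i → ¬? (parts w i ≟ parts v i)) (w∉N[v] ∘ inj₂)
  with i ≟ j
... | yes refl = decidable-stable (parts w i ≟ parts v i) ¬w~v
... | no i≢j   = ⊥-elim (¬w~v (λ w≡v → w~u i (trans w≡v (sym (agree i i≢j)))))

module PrivateNeighbourCode
  (n : ℕ) (a b : Fin (suc n) → ℕ) (b₀≤b : ∀ i → b zero ≤ b i)
  (m : ℕ) (S : Fin m → PVertex (suc n) a b)
  (distinct : IsVertexSet m S) (irr : Irredundant m S) where

  L : Fin (suc n)
  L = fromℕ n

  pn : Fin m → PVertex (suc n) a b
  pn k = proj₁ (irr k)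

  pn-near : ∀ k → InClosedNbhd (pn k) (S k)
  pn-near k = proj₁ (proj₂ (irr k))

  pn-private : ∀ k j → j ≢ k → ¬ InClosedNbhd (pn k) (S j)
  pn-private k = proj₂ (proj₂ (irr k))

  small : (r : Fin (b zero)) → ∀ i → toℕ r < b i
  small r i = <-≤-trans (FinP.toℕ<n r) (b₀≤b i)

  Code : Set
  Code = (Fin (b L) × Fin (∏ (suc n) (λ i → a i * b i)))
       ⊎ ((Bool × Fin (b zero)) × Fin (∏ (suc n) b))

  codeWith : ∀ k → Fin (b zero) → Fin (b L) → InClosedNbhd (pn k) (S k) → Code
  codeWith k r c (inj₁ _) = inj₁ (c , encodeVertex (rotateVertex (toℕ r) (S k)))
  codeWith k r c (inj₂ _) =
    inj₂ ((orient (parts (S k) L) (parts (pn k) L) , r) , encodeΠ (suc n) (setLast (parts (S k)) c))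

  -- A self-private vertex S k is adjacent to no vertex of S (itself included):
  -- otherwise its private neighbour S k would lie in N[S k'].
  selfPrivate-isolated : ∀ {k} k' → pn k ≈ S k → ¬ PAdj (S k) (S k')
  selfPrivate-isolated {k} k' pn≈S Sk~Sk' with k ≟ k'
  ... | yes refl = Sk~Sk' zero refl
  ... | no k≢k'  = pn-private k k' (k≢k' ∘ sym)
                     (inj₂ (λ i e → Sk~Sk' i (trans (cong proj₂ (sym (pn≈S i))) e)))

  selfPrivate-injective : ∀ {k k'} r r' → pn k ≈ S k →
                          rotateVertex (toℕ r) (S k) ≈ rotateVertex (toℕ r') (S k') →
                          k ≡ k' × r ≡ r'
  selfPrivate-injective {k} {k'} r r' pn≈S rot≈ with r ≟ r'
  ... | yes refl = distinct k k' (rotateVertex-injective (small r) rot≈) , refl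
  ... | no r≢r'  = ⊥-elim (selfPrivate-isolated k' pn≈S
                     (rotateVertex-separates (small r) (small r') (r≢r' ∘ FinP.toℕ-injective) rot≈))

  adjacentPrivate-injective : ∀ {k k'} → PAdj (pn k) (S k) → PAdj (pn k') (S k') →
                              (∀ i → i ≢ L → parts (S k) i ≡ parts (S k') i) →
                              orient (parts (S k) L) (parts (pn k) L)
                                ≡ orient (parts (S k') L) (parts (pn k') L) →
                              k ≡ k'
  adjacentPrivate-injective {k} {k'} pn~S pn'~S' agree same-orient with k ≟ k'
  ... | yes k≡k' = k≡k'
  ... | no k≢k'  = ⊥-elim (orient-antisym p p' p≢p' (begin
        orient p p'                  ≡⟨ cong (orient p) pn-last ⟨
        orient p (parts (pn k) L)    ≡⟨ same-orient ⟩
        orient p' (parts (pn k') L)  ≡⟨ cong (orient p') pn'-last ⟩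
        orient p' p                  ∎))
    where
    open ≡-Reasoning
    p p' : Fin (b L)
    p  = parts (S k) L
    p' = parts (S k') L
    pn-last : parts (pn k) L ≡ p'
    pn-last = forcedCoordinate L {u = S k} pn~S (pn-private k k' (k≢k' ∘ sym)) agree
    pn'-last : parts (pn k') L ≡ p
    pn'-last = forcedCoordinate L {u = S k'} pn'~S' (pn-private k' k k≢k') (λ i i≢L → sym (agree i i≢L))
    p≢p' : p ≢ p'
    p≢p' p≡p' = pn~S L (trans pn-last (sym p≡p'))

  codeWith-injective : ∀ k k' r r' c c' near near' →
                       codeWith k r c near ≡ codeWith k' r' c' near' →
                       ((k , r) , c) ≡ ((k' , r') , c')
  codeWith-injective k k' r r' c c' (inj₁ pn≈S) (inj₁ _) eq
    with c≡c' , rot≡ ← ×-≡,≡←≡ (inj₁-injective eq)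
    with refl , refl ← selfPrivate-injective r r' pn≈S (encodeVertex-injective rot≡)
    = cong (_ ,_) c≡c'
  codeWith-injective k k' r r' c c' (inj₂ pn~S) (inj₂ pn'~S') eq
    with bits≡ , enc≡ ← ×-≡,≡←≡ (inj₂-injective eq)
    with orient≡ , r≡r' ← ×-≡,≡←≡ bits≡
    = cong₂ _,_ (cong₂ _,_ k≡k' r≡r') c≡c'
    where
    same : ∀ i → setLast (parts (S k)) c i ≡ setLast (parts (S k')) c' i
    same = encodeΠ-injective (suc n) _ _ enc≡
    c≡c' : c ≡ c'
    c≡c' = trans (sym (setLast-last (parts (S k)) c)) (trans (same L) (setLast-last (parts (S k')) c'))
    agree : ∀ i → i ≢ L → parts (S k) i ≡ parts (S k') i
    agree i i≢L = trans (sym (setLast-other (parts (S k)) c i i≢L))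
                    (trans (same i) (setLast-other (parts (S k')) c' i i≢L))
    k≡k' : k ≡ k'
    k≡k' = adjacentPrivate-injective pn~S pn'~S' agree orient≡
  codeWith-injective k k' r r' c c' (inj₁ _) (inj₂ _) ()
  codeWith-injective k k' r r' c c' (inj₂ _) (inj₁ _) ()

  code : (Fin m × Fin (b zero)) × Fin (b L) → Code
  code ((k , r) , c) = codeWith k r c (pn-near k)

  code-injective : Injective _≡_ _≡_ code
  code-injective {(k , r) , c} {(k' , r') , c'} =
    codeWith-injective k k' r r' c c' (pn-near k) (pn-near k')

≤-via-injection : ∀ {A B : Set} {m n} → Fin m ↔ A → A ↣ B → Fin n ↔ B → m ≤ n
≤-via-injection Fm↔A f Fn↔B =
  FinP.injective⇒≤ (Injection.injective (↔⇒↣ (↔-sym Fn↔B) ↣-∘ (f ↣-∘ ↔⇒↣ Fm↔A)))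

Fin-triple↔ : ∀ {m p q} → Fin (m * p * q) ↔ ((Fin m × Fin p) × Fin q)
Fin-triple↔ = ↔-trans FinP.*↔× (FinP.*↔× ×-↔ ↔-refl)

Fin-code↔ : ∀ {q N p P} →
            Fin (q * N + 2 * p * P) ↔ ((Fin q × Fin N) ⊎ ((Bool × Fin p) × Fin P))
Fin-code↔ = ↔-trans FinP.+↔⊎
  (FinP.*↔× ⊎-↔ ↔-trans FinP.*↔× (↔-trans FinP.*↔× (FinP.2↔Bool ×-↔ ↔-refl) ×-↔ ↔-refl))

-- The hypotheses 1 ≤ a i and 2 ≤ b 0 are not needed; monotonicity of b is
-- used only in the form b 0 ≤ b i.
theorem5p4 : (n : ℕ) (a b : Fin (suc n) → ℕ)
    → ((i : Fin (suc n)) → 1 ≤ a i)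
    → 2 ≤ b zero
    → ((i j : Fin (suc n)) → i ≤ᶠ j → b i ≤ b j)
    → (m : ℕ) (S : Fin m → PVertex (suc n) a b)
    → IsVertexSet m S
    → Irredundant m S
    → m * b zero * b (fromℕ n)
        ≤ b (fromℕ n) * ∏ (suc n) (λ i → a i * b i)
          + 2 * b zero * ∏ (suc n) b
theorem5p4 n a b _ _ b-mono m S distinct irr =
  ≤-via-injection Fin-triple↔ (mk↣ code-injective) Fin-code↔
  where
  open PrivateNeighbourCode n a b (λ i → b-mono zero i z≤n) m S distinct irr
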